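{- Let $B$ be a unital algebra over a field of characteristic zero and $f=I\cdot F\in G^I_B$ with $F\in G^{\mathrm{inv}}_B$. Then $$S_F=S'_F\circ U_F,\qquad U_F^{\circ-1}=S'_F\cdot I\cdot (S'_F)^{ -1}.$$
   Context: $\mathrm{Mult}[[B]]$: sequences $f=(f_n)_{n\ge0}$, $f_n:B^n\to B$ multilinear ($f_0\in B$). $(f\cdot g)_n(x_1,\dots,x_n)=\sum_kf_k(x_1,\dots,x_k)g_{n-k}(x_{k+1},\dots,x_n)$; for $g_0=0$, $(f\circ g)_n(x_1,\dots,x_n)=\sum_{l\ge0}\sum_{k_1+\dots+k_l=n,k_i\ge1}f_l(g_{k_1}(x_1,\dots,x_{k_1}),\dots,g_{k_l}(x_{n-k_l+1},\dots,x_n))$; $I_1=\mathrm{Id}_B$, $I_n=0$ otherwise. $G^{\mathrm{inv}}_B=\{f:f_0\in B^\times\}$ (inverse $f^{ -1}$ under $\cdot$), $G^{\mathrm{dif}}_B=\{f:f_0=0,f_1\in GL(B)\}$ (inverse $f^{\circ-1}$ under $\circ$), $G^I_B=I\cdot G^{\mathrm{inv}}_B$. For $f=I\cdot F\in G^I_B$: the S-transform $S_F:=S_f\in G^{\mathrm{inv}}_B$ is defined by $f^{\circ-1}=I\cdot S_f$; $U_F:=U_f:=S_f^{ -1}\cdot I\cdot S_f$; and the left S-transform $S'_F\in\mathrm{Mult}[[B]]$ is defined by $S'_F\cdot I=(F\cdot I)^{\circ-1}$. -}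

module Defs where

open import Level using (Level; _⊔_; suc)
open import Data.Nat using (ℕ; zero) renaming (suc to sucℕ)
open import Data.List using (List; []; _∷_; _++_; map; concatMap; foldr; length; upTo)
open import Data.List.Relation.Binary.Pointwise using (Pointwise)
open import Data.Product using (_×_; _,_; ∃; proj₁; proj₂)
open import Relation.Nullary using (¬_)
open import Algebra.Bundles using (CommutativeRing; Ring)

module _ {c ℓ} (k : CommutativeRing c ℓ) where
  open CommutativeRing k

  natOne : ℕ → Carrier
  natOne zero = 0#
  natOne (sucℕ n) = 1# + natOne n

  record IsField : Set (c ⊔ ℓ) where
    field
      1≉0     : ¬ (1# ≈ 0#)
      inverse : ∀ a → ¬ (a ≈ 0#) → ∃ λ b → a * b ≈ 1#

  CharZero : Set ℓ
  CharZero = ∀ n → ¬ (natOne (sucℕ n) ≈ 0#)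

-- Unital (associative, not necessarily commutative) algebras over k:
-- a ring B together with a unital ring homomorphism ι : k → Z(B);
-- the scalar multiplication is  a · x = ι a * x.

record UnitalAlgebra {c ℓ} (k : CommutativeRing c ℓ) (b ℓb : Level)
         : Set (c ⊔ ℓ ⊔ suc (b ⊔ ℓb)) where
  module K = CommutativeRing k
  field
    ring : Ring b ℓb
  open Ring ring public
  field
    ι        : K.Carrier → Carrier
    ι-cong   : ∀ {a a′} → a K.≈ a′ → ι a ≈ ι a′
    ι-+      : ∀ a a′ → ι (a K.+ a′) ≈ ι a + ι a′
    ι-*      : ∀ a a′ → ι (a K.* a′) ≈ ι a * ι a′
    ι-1      : ι K.1# ≈ 1#
    ι-central : ∀ a x → ι a * x ≈ x * ι a

  _·_ : K.Carrier → Carrier → Carrier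
  a · x = ι a * x

-- Mult[[B]]: a sequence (f_n)_{n≥0} of multilinear maps f_n : B^n → B
-- is encoded as a single function on lists,  f_n(x₁,…,xₙ) = f (x₁ ∷ … ∷ xₙ ∷ []).

module MultSeries {c ℓ b ℓb} {k : CommutativeRing c ℓ}
                  (A : UnitalAlgebra k b ℓb) where
  open UnitalAlgebra A

  Series : Set b
  Series = List Carrier → Carrier

  record IsMult (f : Series) : Set (c ⊔ b ⊔ ℓb) where
    field
      congruent   : ∀ {xs ys} → Pointwise _≈_ xs ys → f xs ≈ f ys
      multilinear : ∀ (pre post : List Carrier) (a : K.Carrier) (x y : Carrier) →
                    f (pre ++ ((a · x) + y) ∷ post)
                      ≈ (a · f (pre ++ x ∷ post)) + f (pre ++ y ∷ post)

  record Mult : Set (c ⊔ b ⊔ ℓb) where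
    field
      fn     : Series
      isMult : IsMult fn
  open Mult public

  Σ : List Carrier → Carrier
  Σ = foldr _+_ 0#

  splits : List Carrier → List (List Carrier × List Carrier)
  splits [] = ([] , []) ∷ []
  splits (x ∷ xs) = ([] , x ∷ xs) ∷ map (λ p → (x ∷ proj₁ p , proj₂ p)) (splits xs)

  splits⁺ : List Carrier → List (List Carrier × List Carrier)
  splits⁺ [] = []
  splits⁺ (x ∷ xs) = map (λ p → (x ∷ proj₁ p , proj₂ p)) (splits xs)

  -- all argument tuples (g_{k₁}(x₁..x_{k₁}), …, g_{k_l}(…, xₙ)) with k₁+…+k_l = n, kᵢ ≥ 1
  tuples : Series → ℕ → List Carrier → List (List Carrier)
  tuples g zero [] = [] ∷ []
  tuples g zero (_ ∷ _) = []
  tuples g (sucℕ l) xs =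
    concatMap (λ p → map (λ t → g (proj₁ p) ∷ t) (tuples g l (proj₂ p))) (splits⁺ xs)

  _⊙_ : Series → Series → Series
  (f ⊙ g) xs = Σ (map (λ p → f (proj₁ p) * g (proj₂ p)) (splits xs))

  -- (f ∘ g)_n = Σ_{l} Σ_{k₁+…+k_l=n, kᵢ≥1} f_l(g_{k₁}(…),…,g_{k_l}(…))
  -- (the terms with l > n vanish, so l ranges over 0,…,n; g₀ is never used)
  _⊚_ : Series → Series → Series
  (f ⊚ g) xs = Σ (concatMap (λ l → map f (tuples g l xs)) (upTo (sucℕ (length xs))))

  I : Series
  I (x ∷ []) = x
  I _ = 0#

  𝟙 : Series
  𝟙 [] = 1#
  𝟙 (_ ∷ _) = 0#

  _≋_ : Series → Series → Set (b ⊔ ℓb)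
  f ≋ g = ∀ xs → f xs ≈ g xs

  IsMulInverse : Series → Series → Set (b ⊔ ℓb)
  IsMulInverse f g = ((f ⊙ g) ≋ 𝟙) × ((g ⊙ f) ≋ 𝟙)

  IsCompInverse : Series → Series → Set (b ⊔ ℓb)
  IsCompInverse f g = (g [] ≈ 0#) × ((f ⊚ g) ≋ I) × ((g ⊚ f) ≋ I)

  UnitConst : Series → Set (b ⊔ ℓb)
  UnitConst f = ∃ λ u → (f [] * u ≈ 1#) × (u * f [] ≈ 1#)

{-# OPTIONS --safe #-}
-- Write g = I·S, p = S'·I and U = S⁻¹·I·S. Since (f·h)∘u = (f∘u)·(h∘u) and I∘u = u,
-- the identity (I·F)∘g = I becomes I·S·(F∘g) = I, so F∘g = S⁻¹ and (F·I)∘g = U.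
-- Composing with p = (F·I)^(∘-1) on the left and using associativity of ∘ gives
-- p∘U = g, i.e. (S'∘U)·U = S·U, and U can be cancelled on the right.  Symmetrically
-- F∘p = S'⁻¹, and p = p∘U∘U^(∘-1) = g∘U^(∘-1) yields
-- U^(∘-1) = (I·F)∘g∘U^(∘-1) = (I·F)∘p = p·S'⁻¹.
-- The series identities used all come from writing (f∘g)(xs) as a sum of
-- f(g(block₁),…,g(blockₗ)) over the compositions of xs into consecutive nonempty
-- blocks; associativity needs f to be additive in each argument.
module Submission where

open import Defs
open import Level using (Level; _⊔_)
open import Algebra.Bundles using (CommutativeRing; CommutativeMonoid; Semiring)
open import Relation.Binary.Bundles using (Setoid)
open import Data.Product using (_×_; _,_; proj₁; proj₂; swap; uncurry)
open import Data.Nat using (ℕ; zero; suc; _<_; s≤s)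
open import Data.Nat.Properties using (m<n⇒m<1+n; ≤-refl)
open import Data.List using (List; []; _∷_; _++_; map; concatMap; foldr; length; upTo)
open import Data.List.Properties using (++-assoc; map-∘; map-id; map-++; map-concatMap; concatMap-map; concatMap-cong; map-upTo; map-applyUpTo)
open import Data.List.Relation.Binary.Pointwise as Pw using (Pointwise; []; _∷_)
open import Function using (_∘_)
import Algebra.Properties.Group
open import Relation.Binary.PropositionalEquality as ≡ using (_≡_)

private
  variable
    i j : Level
    X : Set i
    Y : Set j

module ListSum {c ℓ} (M : CommutativeMonoid c ℓ) where
  open CommutativeMonoid M
  open import Algebra.Properties.CommutativeSemigroup commutativeSemigroup using (interchange)

  sum : List Carrier → Carrier
  sum = foldr _∙_ ε

  ∑ : (X → Carrier) → List X → Carrier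
  ∑ φ xs = sum (map φ xs)

  sum-++ : ∀ (xs ys : List Carrier) → sum (xs ++ ys) ≈ sum xs ∙ sum ys
  sum-++ []       ys = sym (identityˡ _)
  sum-++ (x ∷ xs) ys = trans (∙-congˡ (sum-++ xs ys)) (sym (assoc _ _ _))

  sum-concatMap : ∀ (h : X → List Carrier) xs → sum (concatMap h xs) ≈ ∑ (sum ∘ h) xs
  sum-concatMap h []       = refl
  sum-concatMap h (x ∷ xs) = trans (sum-++ (h x) _) (∙-congˡ (sum-concatMap h xs))

  ∑-cong : ∀ {φ ψ : X → Carrier} → (∀ x → φ x ≈ ψ x) → ∀ xs → ∑ φ xs ≈ ∑ ψ xs
  ∑-cong φ≈ψ []       = refl
  ∑-cong φ≈ψ (x ∷ xs) = ∙-cong (φ≈ψ x) (∑-cong φ≈ψ xs)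

  ∑-zero : ∀ {φ : X → Carrier} → (∀ x → φ x ≈ ε) → ∀ xs → ∑ φ xs ≈ ε
  ∑-zero φ≈ε []       = refl
  ∑-zero φ≈ε (x ∷ xs) = trans (∙-cong (φ≈ε x) (∑-zero φ≈ε xs)) (identityˡ ε)

  ∑-∙ : ∀ (φ ψ : X → Carrier) xs → ∑ (λ x → φ x ∙ ψ x) xs ≈ ∑ φ xs ∙ ∑ ψ xs
  ∑-∙ φ ψ []       = sym (identityˡ ε)
  ∑-∙ φ ψ (x ∷ xs) = trans (∙-congˡ (∑-∙ φ ψ xs)) (interchange _ _ _ _)

  ∑-comm : ∀ (φ : X → Y → Carrier) xs ys →
           ∑ (λ x → ∑ (φ x) ys) xs ≈ ∑ (λ y → ∑ (λ x → φ x y) xs) ys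
  ∑-comm φ []       ys = sym (∑-zero (λ _ → refl) ys)
  ∑-comm φ (x ∷ xs) ys = trans (∙-congˡ (∑-comm φ xs ys)) (sym (∑-∙ (φ x) _ ys))

  ∑-map : ∀ (φ : Y → Carrier) (h : X → Y) xs → ∑ φ (map h xs) ≡ ∑ (φ ∘ h) xs
  ∑-map φ h xs = ≡.cong sum (≡.sym (map-∘ xs))

  ∑-concatMap : ∀ (φ : Y → Carrier) (h : X → List Y) xs →
                ∑ φ (concatMap h xs) ≈ ∑ (λ x → ∑ φ (h x)) xs
  ∑-concatMap φ h xs = trans (reflexive (≡.cong sum (map-concatMap φ h xs))) (sum-concatMap _ xs)

  ∑-upTo-suc : ∀ (φ : ℕ → Carrier) n → ∑ φ (upTo (suc n)) ≡ φ 0 ∙ ∑ (φ ∘ suc) (upTo n)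
  ∑-upTo-suc φ n = ≡.cong (λ xs → φ 0 ∙ sum xs)
    (≡.trans (map-applyUpTo suc φ n) (≡.sym (map-upTo (φ ∘ suc) n)))

module SemiringSum {c ℓ} (R : Semiring c ℓ) where
  open Semiring R
  open ListSum +-commutativeMonoid

  ∑-distribˡ : ∀ z (φ : X → Carrier) xs → z * ∑ φ xs ≈ ∑ (λ x → z * φ x) xs
  ∑-distribˡ z φ []       = zeroʳ z
  ∑-distribˡ z φ (x ∷ xs) = trans (distribˡ z _ _) (+-congˡ (∑-distribˡ z φ xs))

  ∑-distribʳ : ∀ z (φ : X → Carrier) xs → ∑ φ xs * z ≈ ∑ (λ x → φ x * z) xs
  ∑-distribʳ z φ []       = zeroˡ z
  ∑-distribʳ z φ (x ∷ xs) = trans (distribʳ z _ _) (+-congˡ (∑-distribʳ z φ xs))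

splitsOf : List X → List (List X × List X)
splitsOf []       = ([] , []) ∷ []
splitsOf (x ∷ xs) = ([] , x ∷ xs) ∷ map (λ p → (x ∷ proj₁ p , proj₂ p)) (splitsOf xs)

choices : List (List X) → List (List X)
choices []       = [] ∷ []
choices (l ∷ ls) = concatMap (λ y → map (y ∷_) (choices ls)) l

prepend : X → List (List X) → List (List (List X))
prepend x []       = ((x ∷ []) ∷ []) ∷ []
prepend x (b ∷ bs) = ((x ∷ []) ∷ b ∷ bs) ∷ ((x ∷ b) ∷ bs) ∷ []

compositions : List X → List (List (List X))
compositions []       = [] ∷ []
compositions (x ∷ xs) = concatMap (prepend x) (compositions xs)

singletons : List X → List (List X)
singletons = map (_∷ [])

-- only ever applied to nonempty compositions
mergeHead : X → List (List X) → List (List X)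
mergeHead x []       = []
mergeHead x (b ∷ bs) = (x ∷ b) ∷ bs

prepend₂ : X → List (List (List X)) → List (List (List (List X)))
prepend₂ x []         = (((x ∷ []) ∷ []) ∷ []) ∷ []
prepend₂ x (g ∷ gs) = (((x ∷ []) ∷ []) ∷ g ∷ gs) ∷ map (_∷ gs) (prepend x g)

compositions-map : ∀ (h : X → Y) xs → compositions (map h xs) ≡ map (map (map h)) (compositions xs)
compositions-map h []       = ≡.refl
compositions-map h (x ∷ xs) = begin
  concatMap (prepend (h x)) (compositions (map h xs))
    ≡⟨ ≡.cong (concatMap (prepend (h x))) (compositions-map h xs) ⟩
  concatMap (prepend (h x)) (map (map (map h)) (compositions xs))
    ≡⟨ concatMap-map (prepend (h x)) (map (map h)) (compositions xs) ⟩
  concatMap (prepend (h x) ∘ map (map h)) (compositions xs)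
    ≡⟨ concatMap-cong prepend-map (compositions xs) ⟩
  concatMap (map (map (map h)) ∘ prepend x) (compositions xs)
    ≡⟨ map-concatMap (map (map h)) (prepend x) (compositions xs) ⟨
  map (map (map h)) (concatMap (prepend x) (compositions xs)) ∎
  where
  open ≡.≡-Reasoning
  prepend-map : ∀ c → prepend (h x) (map (map h) c) ≡ map (map (map h)) (prepend x c)
  prepend-map []      = ≡.refl
  prepend-map (_ ∷ _) = ≡.refl

module CompositionSum {c ℓ} (M : CommutativeMonoid c ℓ) where
  open CommutativeMonoid M
  open ListSum M
  open import Algebra.Solver.CommutativeMonoid M using (solve; _⊜_; _⊕_) renaming (id to ∅)
  open import Relation.Binary.Reasoning.Setoid setoid

  private
    ∙-vanish₂ : ∀ {u v} → u ≈ ε → v ≈ ε → u ∙ (v ∙ ε) ≈ ε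
    ∙-vanish₂ u≈ε v≈ε = trans (∙-cong u≈ε (trans (∙-congʳ v≈ε) (identityˡ ε))) (identityˡ ε)

  ∑-compositions-∷ : ∀ (ψ : List (List X) → Carrier) x xs →
    ∑ ψ (compositions (x ∷ xs)) ≈ ∑ (λ c → ∑ ψ (prepend x c)) (compositions xs)
  ∑-compositions-∷ ψ x xs = ∑-concatMap ψ (prepend x) (compositions xs)

  ∑-choices-∷ : ∀ (F : List X → Carrier) l ls →
    ∑ F (choices (l ∷ ls)) ≈ ∑ (λ y → ∑ (λ ys → F (y ∷ ys)) (choices ls)) l
  ∑-choices-∷ F l ls =
    trans (∑-concatMap F _ l) (∑-cong (λ y → reflexive (∑-map F (y ∷_) (choices ls))) l)

  ∑-splitsOf-∷ : ∀ (Ψ : List X → List X → Carrier) x xs →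
    ∑ (uncurry Ψ) (splitsOf (x ∷ xs)) ≡ Ψ [] (x ∷ xs) ∙ ∑ (uncurry (Ψ ∘ (x ∷_))) (splitsOf xs)
  ∑-splitsOf-∷ Ψ x xs = ≡.cong (Ψ [] (x ∷ xs) ∙_) (∑-map _ _ (splitsOf xs))

  ∑-compositions-∷-∷ : ∀ (ψ : List (List X) → Carrier) x y ys →
    ∑ ψ (compositions (x ∷ y ∷ ys))
      ≈ ∑ (λ c → ψ ((x ∷ []) ∷ c)) (compositions (y ∷ ys)) ∙ ∑ (ψ ∘ mergeHead x) (compositions (y ∷ ys))
  ∑-compositions-∷-∷ ψ x y ys = begin
    ∑ ψ (compositions (x ∷ y ∷ ys))
      ≈⟨ ∑-compositions-∷ ψ x (y ∷ ys) ⟩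
    ∑ (λ c → ∑ ψ (prepend x c)) (compositions (y ∷ ys))
      ≈⟨ ∑-compositions-∷ _ y ys ⟩
    ∑ (λ c → ∑ (λ c′ → ∑ ψ (prepend x c′)) (prepend y c)) (compositions ys)
      ≈⟨ ∑-cong split-prepend (compositions ys) ⟩
    ∑ (λ c → ∑ ψ′ (prepend y c)) (compositions ys)
      ≈⟨ ∑-compositions-∷ ψ′ y ys ⟨
    ∑ ψ′ (compositions (y ∷ ys))
      ≈⟨ ∑-∙ _ _ (compositions (y ∷ ys)) ⟩
    ∑ (λ c → ψ ((x ∷ []) ∷ c)) (compositions (y ∷ ys)) ∙ ∑ (ψ ∘ mergeHead x) (compositions (y ∷ ys)) ∎
    where
    ψ′ : List (List _) → Carrier
    ψ′ c = ψ ((x ∷ []) ∷ c) ∙ ψ (mergeHead x c)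
    split-prepend : ∀ c → ∑ (λ c′ → ∑ ψ (prepend x c′)) (prepend y c) ≈ ∑ ψ′ (prepend y c)
    split-prepend []      = ∙-congʳ (∙-congˡ (identityʳ _))
    split-prepend (_ ∷ _) = ∙-cong (∙-congˡ (identityʳ _)) (∙-congʳ (∙-congˡ (identityʳ _)))

  ∑-compositions-oneBlock : ∀ (ψ : List (List X) → Carrier) →
    (∀ b b′ bs → ψ (b ∷ b′ ∷ bs) ≈ ε) →
    ∀ x xs → ∑ ψ (compositions (x ∷ xs)) ≈ ψ ((x ∷ xs) ∷ [])
  ∑-compositions-oneBlock ψ vanish x []       = identityʳ _
  ∑-compositions-oneBlock ψ vanish x (y ∷ ys) = begin
    ∑ ψ (compositions (x ∷ y ∷ ys))
      ≈⟨ ∑-compositions-∷ ψ x (y ∷ ys) ⟩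
    ∑ (λ c → ∑ ψ (prepend x c)) (compositions (y ∷ ys))
      ≈⟨ ∑-compositions-oneBlock _ vanish′ y ys ⟩
    ψ ((x ∷ []) ∷ (y ∷ ys) ∷ []) ∙ (ψ ((x ∷ y ∷ ys) ∷ []) ∙ ε)
      ≈⟨ ∙-cong (vanish _ _ _) (identityʳ _) ⟩
    ε ∙ ψ ((x ∷ y ∷ ys) ∷ [])
      ≈⟨ identityˡ _ ⟩
    ψ ((x ∷ y ∷ ys) ∷ []) ∎
    where
    vanish′ : ∀ b b′ bs → ∑ ψ (prepend x (b ∷ b′ ∷ bs)) ≈ ε
    vanish′ b b′ bs = ∙-vanish₂ (vanish _ _ _) (vanish _ _ _)

  ∑-compositions-singletons : ∀ (ψ : List (List X) → Carrier) →
    (∀ pre x y b post → ψ (pre ++ (x ∷ y ∷ b) ∷ post) ≈ ε) →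
    ∀ xs → ∑ ψ (compositions xs) ≈ ψ (singletons xs)
  ∑-compositions-singletons ψ vanish []           = identityʳ _
  ∑-compositions-singletons ψ vanish (x ∷ [])     = identityʳ _
  ∑-compositions-singletons ψ vanish (x ∷ y ∷ ys) = begin
    ∑ ψ (compositions (x ∷ y ∷ ys))
      ≈⟨ ∑-compositions-∷ ψ x (y ∷ ys) ⟩
    ∑ (λ c → ∑ ψ (prepend x c)) (compositions (y ∷ ys))
      ≈⟨ ∑-compositions-singletons _ vanish′ (y ∷ ys) ⟩
    ψ (singletons (x ∷ y ∷ ys)) ∙ (ψ ((x ∷ y ∷ []) ∷ singletons ys) ∙ ε)
      ≈⟨ ∙-congˡ (trans (identityʳ _) (vanish [] x y [] (singletons ys))) ⟩
    ψ (singletons (x ∷ y ∷ ys)) ∙ ε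
      ≈⟨ identityʳ _ ⟩
    ψ (singletons (x ∷ y ∷ ys)) ∎
    where
    vanish′ : ∀ pre x′ y′ b post → ∑ ψ (prepend x (pre ++ (x′ ∷ y′ ∷ b) ∷ post)) ≈ ε
    vanish′ []        x′ y′ b post =
      ∙-vanish₂ (vanish ((x ∷ []) ∷ []) x′ y′ b post) (vanish [] x x′ (y′ ∷ b) post)
    vanish′ (p ∷ pre) x′ y′ b post =
      ∙-vanish₂ (vanish ((x ∷ []) ∷ p ∷ pre) x′ y′ b post) (vanish ((x ∷ p) ∷ pre) x′ y′ b post)

  ∑-prepend-splitsOf : ∀ (Ψ : List (List X) → List (List X) → Carrier) x c →
    ∑ (Ψ []) (prepend x c) ∙ ∑ (λ p → ∑ (λ c₁ → Ψ c₁ (proj₂ p)) (prepend x (proj₁ p))) (splitsOf c)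
      ≈ ∑ (λ c′ → ∑ (uncurry Ψ) (splitsOf c′)) (prepend x c)
  ∑-prepend-splitsOf Ψ x []      =
    solve 2 (λ a b → (a ⊕ ∅) ⊕ ((b ⊕ ∅) ⊕ ∅) ⊜ (a ⊕ (b ⊕ ∅)) ⊕ ∅) refl _ _
  ∑-prepend-splitsOf Ψ x (b ∷ r) = begin
    (α ∙ (γ ∙ ε)) ∙ ∑ (uncurry Ψ′) (splitsOf (b ∷ r))
      ≡⟨ ≡.cong ((α ∙ (γ ∙ ε)) ∙_) (∑-splitsOf-∷ Ψ′ b r) ⟩
    (α ∙ (γ ∙ ε)) ∙ ((β ∙ ε) ∙ ∑ (uncurry (Ψ′ ∘ (b ∷_))) (splitsOf r))
      ≈⟨ ∙-congˡ (∙-congˡ (trans (∑-cong (λ _ → ∙-congˡ (identityʳ _)) (splitsOf r)) (∑-∙ _ _ (splitsOf r)))) ⟩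
    (α ∙ (γ ∙ ε)) ∙ ((β ∙ ε) ∙ (σ ∙ τ))
      ≈⟨ solve 5 (λ α β γ σ τ → (α ⊕ (γ ⊕ ∅)) ⊕ ((β ⊕ ∅) ⊕ (σ ⊕ τ)) ⊜ (α ⊕ (β ⊕ σ)) ⊕ ((γ ⊕ τ) ⊕ ∅))
                 refl α β γ σ τ ⟩
    (α ∙ (β ∙ σ)) ∙ ((γ ∙ τ) ∙ ε)
      ≡⟨ ≡.cong₂ (λ u v → u ∙ (v ∙ ε))
           (≡.trans (∑-splitsOf-∷ Ψ (x ∷ []) (b ∷ r)) (≡.cong (α ∙_) (∑-splitsOf-∷ (Ψ ∘ ((x ∷ []) ∷_)) b r)))
           (∑-splitsOf-∷ Ψ (x ∷ b) r) ⟨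
    ∑ (λ c′ → ∑ (uncurry Ψ) (splitsOf c′)) (prepend x (b ∷ r)) ∎
    where
    Ψ′ : List (List _) → List (List _) → Carrier
    Ψ′ c₁ c₂ = ∑ (λ c₁′ → Ψ c₁′ c₂) (prepend x c₁)
    α = Ψ [] ((x ∷ []) ∷ b ∷ r)
    β = Ψ ((x ∷ []) ∷ []) (b ∷ r)
    γ = Ψ [] ((x ∷ b) ∷ r)
    σ = ∑ (uncurry (Ψ ∘ ((x ∷ []) ∷_) ∘ (b ∷_))) (splitsOf r)
    τ = ∑ (uncurry (Ψ ∘ ((x ∷ b) ∷_))) (splitsOf r)

  ∑-compositions² : (List (List X) → List (List X) → Carrier) → List X → List X → Carrier
  ∑-compositions² Ψ u v = ∑ (λ c₁ → ∑ (Ψ c₁) (compositions v)) (compositions u)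

  ∑-compositions-splitsOf : ∀ (Ψ : List (List X) → List (List X) → Carrier) xs →
    ∑ (λ c → ∑ (uncurry Ψ) (splitsOf c)) (compositions xs) ≈ ∑ (uncurry (∑-compositions² Ψ)) (splitsOf xs)
  ∑-compositions-splitsOf Ψ []       = sym (identityʳ _)
  ∑-compositions-splitsOf Ψ (x ∷ xs) = begin
    ∑ (λ c → ∑ (uncurry Ψ) (splitsOf c)) (compositions (x ∷ xs))
      ≈⟨ ∑-compositions-∷ _ x xs ⟩
    ∑ (λ c → ∑ (λ c′ → ∑ (uncurry Ψ) (splitsOf c′)) (prepend x c)) (compositions xs)
      ≈⟨ ∑-cong (∑-prepend-splitsOf Ψ x) (compositions xs) ⟨
    ∑ (λ c → ∑ (Ψ []) (prepend x c) ∙ ∑ (uncurry Ψ′) (splitsOf c)) (compositions xs)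
      ≈⟨ ∑-∙ _ _ (compositions xs) ⟩
    ∑ (λ c → ∑ (Ψ []) (prepend x c)) (compositions xs) ∙ ∑ (λ c → ∑ (uncurry Ψ′) (splitsOf c)) (compositions xs)
      ≈⟨ ∙-cong (trans (identityʳ _) (∑-compositions-∷ (Ψ []) x xs)) (sym (∑-compositions-splitsOf Ψ′ xs)) ⟨
    (∑ (Ψ []) (compositions (x ∷ xs)) ∙ ε) ∙ ∑ (uncurry (∑-compositions² Ψ′)) (splitsOf xs)
      ≈⟨ ∙-congˡ (∑-cong (λ p → prepend-first-block (proj₁ p) (proj₂ p)) (splitsOf xs)) ⟩
    ∑-compositions² Ψ [] (x ∷ xs) ∙ ∑ (uncurry (∑-compositions² Ψ ∘ (x ∷_))) (splitsOf xs)
      ≡⟨ ∑-splitsOf-∷ (∑-compositions² Ψ) x xs ⟨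
    ∑ (uncurry (∑-compositions² Ψ)) (splitsOf (x ∷ xs)) ∎
    where
    Ψ′ : List (List _) → List (List _) → Carrier
    Ψ′ c₁ c₂ = ∑ (λ c₁′ → Ψ c₁′ c₂) (prepend x c₁)
    prepend-first-block : ∀ u v → ∑-compositions² Ψ′ u v ≈ ∑-compositions² Ψ (x ∷ u) v
    prepend-first-block u v = begin
      ∑ (λ c₁ → ∑ (Ψ′ c₁) (compositions v)) (compositions u)
        ≈⟨ ∑-cong (λ c₁ → ∑-comm Ψ (prepend x c₁) (compositions v)) (compositions u) ⟨
      ∑ (λ c₁ → ∑ (λ c₁′ → ∑ (Ψ c₁′) (compositions v)) (prepend x c₁)) (compositions u)
        ≈⟨ ∑-compositions-∷ _ x u ⟨
      ∑ (λ c₁ → ∑ (Ψ c₁) (compositions v)) (compositions (x ∷ u)) ∎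

  ∑-prepend-compositions : ∀ (F : List (List (List X)) → Carrier) x c →
    ∑ (λ c′ → ∑ F (compositions c′)) (prepend x c) ≈ ∑ (λ d → ∑ F (prepend₂ x d)) (compositions c)
  ∑-prepend-compositions F x []      = refl
  ∑-prepend-compositions F x (b ∷ r) = begin
    ∑ F (compositions ((x ∷ []) ∷ b ∷ r)) ∙ (∑ F (compositions ((x ∷ b) ∷ r)) ∙ ε)
      ≈⟨ ∙-cong (trans (∑-compositions-∷ F (x ∷ []) (b ∷ r)) (∑-compositions-∷ _ b r))
                (trans (identityʳ _) (∑-compositions-∷ F (x ∷ b) r)) ⟩
    ∑ (λ d′ → ∑ (λ d → ∑ F (prepend (x ∷ []) d)) (prepend b d′)) (compositions r)
      ∙ ∑ (λ d′ → ∑ F (prepend (x ∷ b) d′)) (compositions r)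
      ≈⟨ ∑-∙ _ _ (compositions r) ⟨
    ∑ (λ d′ → ∑ (λ d → ∑ F (prepend (x ∷ []) d)) (prepend b d′) ∙ ∑ F (prepend (x ∷ b) d′)) (compositions r)
      ≈⟨ ∑-cong regroup (compositions r) ⟩
    ∑ (λ d′ → ∑ (λ d → ∑ F (prepend₂ x d)) (prepend b d′)) (compositions r)
      ≈⟨ ∑-compositions-∷ _ b r ⟨
    ∑ (λ d → ∑ F (prepend₂ x d)) (compositions (b ∷ r)) ∎
    where
    regroup : ∀ d′ → ∑ (λ d → ∑ F (prepend (x ∷ []) d)) (prepend b d′) ∙ ∑ F (prepend (x ∷ b) d′)
                     ≈ ∑ (λ d → ∑ F (prepend₂ x d)) (prepend b d′)
    regroup []      = solve 3 (λ p q r → ((p ⊕ (q ⊕ ∅)) ⊕ ∅) ⊕ (r ⊕ ∅) ⊜ (p ⊕ (q ⊕ (r ⊕ ∅))) ⊕ ∅) refl _ _ _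
    regroup (_ ∷ _) = solve 6 (λ p q r s t u → ((p ⊕ (q ⊕ ∅)) ⊕ ((r ⊕ (s ⊕ ∅)) ⊕ ∅)) ⊕ (t ⊕ (u ⊕ ∅))
                                              ⊜ (p ⊕ (q ⊕ (t ⊕ ∅))) ⊕ ((r ⊕ (s ⊕ (u ⊕ ∅))) ⊕ ∅)) refl _ _ _ _ _ _

  ∑-prepend-choices : ∀ (F : List (List (List X)) → Carrier) x e →
    ∑ (λ e′ → ∑ F (choices (map compositions e′))) (prepend x e)
      ≈ ∑ (λ d → ∑ F (prepend₂ x d)) (choices (map compositions e))
  ∑-prepend-choices F x []      = refl
  ∑-prepend-choices F x (b ∷ r) = begin
    ∑ F (choices (map compositions ((x ∷ []) ∷ b ∷ r))) ∙ (∑ F (choices (map compositions ((x ∷ b) ∷ r))) ∙ ε)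
      ≈⟨ ∙-cong (trans (∑-choices-∷ F (compositions (x ∷ [])) (compositions b ∷ rs))
                       (trans (identityʳ _) (∑-choices-∷ (λ d → F (((x ∷ []) ∷ []) ∷ d)) (compositions b) rs)))
                (trans (identityʳ _) (trans (∑-choices-∷ F (compositions (x ∷ b)) rs)
                                            (∑-compositions-∷ (λ a′ → ∑ (λ r′ → F (a′ ∷ r′)) R) x b))) ⟩
    ∑ (λ a → ∑ (λ r′ → F (((x ∷ []) ∷ []) ∷ a ∷ r′)) R) (compositions b)
      ∙ ∑ (λ a → ∑ (λ a′ → ∑ (λ r′ → F (a′ ∷ r′)) R) (prepend x a)) (compositions b)
      ≈⟨ ∙-congˡ (∑-cong (λ a → ∑-comm (λ a′ r′ → F (a′ ∷ r′)) (prepend x a) R) (compositions b)) ⟩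
    ∑ (λ a → ∑ (λ r′ → F (((x ∷ []) ∷ []) ∷ a ∷ r′)) R) (compositions b)
      ∙ ∑ (λ a → ∑ (λ r′ → ∑ (λ a′ → F (a′ ∷ r′)) (prepend x a)) R) (compositions b)
      ≈⟨ trans (∑-cong (λ a → ∑-∙ _ _ R) (compositions b)) (∑-∙ _ _ (compositions b)) ⟨
    ∑ (λ a → ∑ (λ r′ → F (((x ∷ []) ∷ []) ∷ a ∷ r′) ∙ ∑ (λ a′ → F (a′ ∷ r′)) (prepend x a)) R) (compositions b)
      ≈⟨ ∑-cong (λ a → ∑-cong (λ r′ → ∙-congˡ (reflexive (∑-map F (_∷ r′) (prepend x a)))) R) (compositions b) ⟨
    ∑ (λ a → ∑ (λ r′ → ∑ F (prepend₂ x (a ∷ r′))) R) (compositions b)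
      ≈⟨ ∑-choices-∷ _ (compositions b) rs ⟨
    ∑ (λ d → ∑ F (prepend₂ x d)) (choices (map compositions (b ∷ r))) ∎
    where
    rs = map compositions r
    R = choices rs

  -- Both sides sum F over the two-level compositions of xs, and both obey the same
  -- recursion in the head of xs, through prepend₂.
  ∑-compositions-compositions : ∀ (F : List (List (List X)) → Carrier) xs →
    ∑ (λ c → ∑ F (compositions c)) (compositions xs)
      ≈ ∑ (λ e → ∑ F (choices (map compositions e))) (compositions xs)
  ∑-compositions-compositions F []       = refl
  ∑-compositions-compositions F (x ∷ xs) = begin
    ∑ (λ c → ∑ F (compositions c)) (compositions (x ∷ xs))
      ≈⟨ ∑-compositions-∷ _ x xs ⟩
    ∑ (λ c → ∑ (λ c′ → ∑ F (compositions c′)) (prepend x c)) (compositions xs)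
      ≈⟨ ∑-cong (∑-prepend-compositions F x) (compositions xs) ⟩
    ∑ (λ c → ∑ F′ (compositions c)) (compositions xs)
      ≈⟨ ∑-compositions-compositions F′ xs ⟩
    ∑ (λ e → ∑ F′ (choices (map compositions e))) (compositions xs)
      ≈⟨ ∑-cong (∑-prepend-choices F x) (compositions xs) ⟨
    ∑ (λ e → ∑ (λ e′ → ∑ F (choices (map compositions e′))) (prepend x e)) (compositions xs)
      ≈⟨ ∑-compositions-∷ _ x xs ⟨
    ∑ (λ e → ∑ F (choices (map compositions e))) (compositions (x ∷ xs)) ∎
    where
    F′ : List (List (List _)) → Carrier
    F′ d = ∑ F (prepend₂ x d)

module SeriesAlgebra {c ℓ b ℓb} {k : CommutativeRing c ℓ} (A : UnitalAlgebra k b ℓb) where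
  open UnitalAlgebra A
  open MultSeries A
  open ListSum +-commutativeMonoid
  open SemiringSum semiring
  open CompositionSum +-commutativeMonoid
  open import Relation.Binary.Reasoning.Setoid setoid
  private module G = Algebra.Properties.Group +-group
  open import Algebra.Properties.CommutativeSemigroup +-commutativeSemigroup using () renaming (interchange to +-interchange)

  ≋-setoid : Setoid b (b ⊔ ℓb)
  ≋-setoid = record
    { Carrier       = Series
    ; _≈_           = _≋_
    ; isEquivalence = record
      { refl  = λ _ → refl
      ; sym   = λ f≋g xs → sym (f≋g xs)
      ; trans = λ f≋g g≋h xs → trans (f≋g xs) (g≋h xs)
      }
    }

  open Setoid ≋-setoid public using () renaming (trans to ≋-trans)

  shift : Carrier → Series → Series
  shift x f ys = f (x ∷ ys)

  Congruent : Series → Set (b ⊔ ℓb)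
  Congruent f = ∀ {xs ys} → Pointwise _≈_ xs ys → f xs ≈ f ys

  Additive : Series → Set (b ⊔ ℓb)
  Additive f = ∀ pre post x y → f (pre ++ x + y ∷ post) ≈ f (pre ++ x ∷ post) + f (pre ++ y ∷ post)

  record IsMultiAdditive (f : Series) : Set (b ⊔ ℓb) where
    field
      congruent : Congruent f
      additive  : Additive f

    additive-zero : ∀ pre post → f (pre ++ 0# ∷ post) ≈ 0#
    additive-zero pre post = G.identityʳ-unique (f (pre ++ 0# ∷ post)) (f (pre ++ 0# ∷ post)) (begin
      f (pre ++ 0# ∷ post) + f (pre ++ 0# ∷ post) ≈⟨ additive pre post 0# 0# ⟨
      f (pre ++ 0# + 0# ∷ post)                   ≈⟨ congruent (Pw.++⁺ (Pw.refl refl) (+-identityʳ 0# ∷ Pw.refl refl)) ⟩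
      f (pre ++ 0# ∷ post)                        ∎)

    additive-∑ : ∀ pre post (φ : X → Carrier) l →
      f (pre ++ ∑ φ l ∷ post) ≈ ∑ (λ y → f (pre ++ φ y ∷ post)) l
    additive-∑ pre post φ []      = additive-zero pre post
    additive-∑ pre post φ (y ∷ l) = trans (additive pre post _ _) (+-congˡ (additive-∑ pre post φ l))

    additive-choices : ∀ pre (φ : X → Carrier) ls →
      f (pre ++ map (∑ φ) ls) ≈ ∑ (λ ys → f (pre ++ map φ ys)) (choices ls)
    additive-choices pre φ []       = sym (+-identityʳ _)
    additive-choices pre φ (l ∷ ls) = begin
      f (pre ++ ∑ φ l ∷ map (∑ φ) ls)
        ≈⟨ additive-∑ pre _ φ l ⟩
      ∑ (λ y → f (pre ++ φ y ∷ map (∑ φ) ls)) l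
        ≈⟨ ∑-cong expand-rest l ⟩
      ∑ (λ y → ∑ (λ ys → f (pre ++ map φ (y ∷ ys))) (choices ls)) l
        ≈⟨ ∑-choices-∷ (λ ys → f (pre ++ map φ ys)) l ls ⟨
      ∑ (λ ys → f (pre ++ map φ ys)) (choices (l ∷ ls)) ∎
      where
      expand-rest : ∀ y → f (pre ++ φ y ∷ map (∑ φ) ls) ≈ ∑ (λ ys → f (pre ++ map φ (y ∷ ys))) (choices ls)
      expand-rest y = begin
        f (pre ++ φ y ∷ map (∑ φ) ls)
          ≡⟨ ≡.cong f (++-assoc pre (φ y ∷ []) (map (∑ φ) ls)) ⟨
        f ((pre ++ φ y ∷ []) ++ map (∑ φ) ls)
          ≈⟨ additive-choices (pre ++ φ y ∷ []) φ ls ⟩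
        ∑ (λ ys → f ((pre ++ φ y ∷ []) ++ map φ ys)) (choices ls)
          ≈⟨ ∑-cong (λ ys → reflexive (≡.cong f (++-assoc pre (φ y ∷ []) (map φ ys)))) (choices ls) ⟩
        ∑ (λ ys → f (pre ++ map φ (y ∷ ys))) (choices ls) ∎

  open IsMultiAdditive public

  Mult⇒isMultiAdditive : (F : Mult) → IsMultiAdditive (fn F)
  Mult⇒isMultiAdditive F = record
    { congruent = IsMult.congruent (isMult F)
    ; additive  = λ pre post x y → begin
        fn F (pre ++ x + y ∷ post)
          ≈⟨ IsMult.congruent (isMult F) (Pw.++⁺ (Pw.refl refl) (+-congʳ (sym ι1·x) ∷ Pw.refl refl)) ⟩
        fn F (pre ++ K.1# · x + y ∷ post)
          ≈⟨ IsMult.multilinear (isMult F) pre post K.1# x y ⟩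
        K.1# · fn F (pre ++ x ∷ post) + fn F (pre ++ y ∷ post)
          ≈⟨ +-congʳ ι1·x ⟩
        fn F (pre ++ x ∷ post) + fn F (pre ++ y ∷ post) ∎
    }
    where
    ι1·x : ∀ {x} → K.1# · x ≈ x
    ι1·x = trans (*-congʳ ι-1) (*-identityˡ _)

  ⊙-[] : ∀ f g → (f ⊙ g) [] ≈ f [] * g []
  ⊙-[] f g = +-identityʳ _

  ⊙-∷ : ∀ f g x xs → (f ⊙ g) (x ∷ xs) ≡ f [] * g (x ∷ xs) + (shift x f ⊙ g) xs
  ⊙-∷ f g x xs = ≡.cong (f [] * g (x ∷ xs) +_) (∑-map _ _ (splits xs))

  ⊙-congˡ : ∀ {f f′} g → f ≋ f′ → (f ⊙ g) ≋ (f′ ⊙ g)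
  ⊙-congˡ g f≋f′ xs = ∑-cong (λ p → *-congʳ (f≋f′ (proj₁ p))) (splits xs)

  ⊙-congʳ : ∀ f {g g′} → g ≋ g′ → (f ⊙ g) ≋ (f ⊙ g′)
  ⊙-congʳ f g≋g′ xs = ∑-cong (λ p → *-congˡ (g≋g′ (proj₂ p))) (splits xs)

  ⊙-cong : ∀ {f f′ g g′} → f ≋ f′ → g ≋ g′ → (f ⊙ g) ≋ (f′ ⊙ g′)
  ⊙-cong {f′ = f′} {g} f≋f′ g≋g′ = ≋-trans (⊙-congˡ g f≋f′) (⊙-congʳ f′ g≋g′)

  ⊙-distribʳ : ∀ f f′ g xs → ((λ ys → f ys + f′ ys) ⊙ g) xs ≈ (f ⊙ g) xs + (f′ ⊙ g) xs
  ⊙-distribʳ f f′ g xs = trans (∑-cong (λ p → distribʳ _ _ _) (splits xs)) (∑-∙ _ _ (splits xs))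

  ⊙-*ˡ : ∀ z f g xs → ((λ ys → z * f ys) ⊙ g) xs ≈ z * (f ⊙ g) xs
  ⊙-*ˡ z f g xs = trans (∑-cong (λ p → *-assoc _ _ _) (splits xs)) (sym (∑-distribˡ z _ (splits xs)))

  ⊙-zeroˡ : ∀ g xs → ((λ _ → 0#) ⊙ g) xs ≈ 0#
  ⊙-zeroˡ g xs = ∑-zero (λ p → zeroˡ _) (splits xs)

  ⊙-identityˡ : ∀ f → (𝟙 ⊙ f) ≋ f
  ⊙-identityˡ f []       = trans (⊙-[] 𝟙 f) (*-identityˡ _)
  ⊙-identityˡ f (x ∷ xs) = begin
    (𝟙 ⊙ f) (x ∷ xs)                      ≡⟨ ⊙-∷ 𝟙 f x xs ⟩
    1# * f (x ∷ xs) + (shift x 𝟙 ⊙ f) xs  ≈⟨ +-cong (*-identityˡ _) (⊙-zeroˡ f xs) ⟩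
    f (x ∷ xs) + 0#                       ≈⟨ +-identityʳ _ ⟩
    f (x ∷ xs)                            ∎

  ⊙-identityʳ : ∀ f → (f ⊙ 𝟙) ≋ f
  ⊙-identityʳ f []       = trans (⊙-[] f 𝟙) (*-identityʳ _)
  ⊙-identityʳ f (x ∷ xs) = begin
    (f ⊙ 𝟙) (x ∷ xs)                  ≡⟨ ⊙-∷ f 𝟙 x xs ⟩
    f [] * 0# + (shift x f ⊙ 𝟙) xs    ≈⟨ +-cong (zeroʳ _) (⊙-identityʳ (shift x f) xs) ⟩
    0# + f (x ∷ xs)                   ≈⟨ +-identityˡ _ ⟩
    f (x ∷ xs)                        ∎

  ⊙-assoc : ∀ f g h → ((f ⊙ g) ⊙ h) ≋ (f ⊙ (g ⊙ h))
  ⊙-assoc f g h [] = begin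
    ((f ⊙ g) ⊙ h) []       ≈⟨ trans (⊙-[] (f ⊙ g) h) (*-congʳ (⊙-[] f g)) ⟩
    (f [] * g []) * h []   ≈⟨ *-assoc _ _ _ ⟩
    f [] * (g [] * h [])   ≈⟨ trans (⊙-[] f (g ⊙ h)) (*-congˡ (⊙-[] g h)) ⟨
    (f ⊙ (g ⊙ h)) []       ∎
  ⊙-assoc f g h (x ∷ xs) = begin
    ((f ⊙ g) ⊙ h) (x ∷ xs)
      ≡⟨ ⊙-∷ (f ⊙ g) h x xs ⟩
    (f ⊙ g) [] * h (x ∷ xs) + (shift x (f ⊙ g) ⊙ h) xs
      ≈⟨ +-cong (*-congʳ (⊙-[] f g)) (⊙-congˡ h (λ ys → reflexive (⊙-∷ f g x ys)) xs) ⟩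
    (f [] * g []) * h (x ∷ xs) + ((λ ys → f [] * shift x g ys + (shift x f ⊙ g) ys) ⊙ h) xs
      ≈⟨ +-cong (*-assoc _ _ _) (⊙-distribʳ _ _ h xs) ⟩
    f [] * (g [] * h (x ∷ xs)) + (((λ ys → f [] * shift x g ys) ⊙ h) xs + ((shift x f ⊙ g) ⊙ h) xs)
      ≈⟨ +-congˡ (+-cong (⊙-*ˡ _ _ h xs) (⊙-assoc (shift x f) g h xs)) ⟩
    f [] * (g [] * h (x ∷ xs)) + (f [] * (shift x g ⊙ h) xs + (shift x f ⊙ (g ⊙ h)) xs)
      ≈⟨ +-assoc _ _ _ ⟨
    (f [] * (g [] * h (x ∷ xs)) + f [] * (shift x g ⊙ h) xs) + (shift x f ⊙ (g ⊙ h)) xs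
      ≈⟨ +-congʳ (distribˡ _ _ _) ⟨
    f [] * (g [] * h (x ∷ xs) + (shift x g ⊙ h) xs) + (shift x f ⊙ (g ⊙ h)) xs
      ≡⟨ ≡.cong (λ z → f [] * z + (shift x f ⊙ (g ⊙ h)) xs) (⊙-∷ g h x xs) ⟨
    f [] * (g ⊙ h) (x ∷ xs) + (shift x f ⊙ (g ⊙ h)) xs
      ≡⟨ ⊙-∷ f (g ⊙ h) x xs ⟨
    (f ⊙ (g ⊙ h)) (x ∷ xs) ∎

  private
    split-*+ : ∀ {a u u₁ u₂ v v₁ v₂} → u ≈ u₁ + u₂ → v ≈ v₁ + v₂ →
               a * u + v ≈ (a * u₁ + v₁) + (a * u₂ + v₂)
    split-*+ u≈ v≈ = trans (+-cong (trans (*-congˡ u≈) (distribˡ _ _ _)) v≈) (+-interchange _ _ _ _)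

  ⊙-congruent : ∀ {f g} → Congruent f → Congruent g → Congruent (f ⊙ g)
  ⊙-congruent f-cong g-cong [] = refl
  ⊙-congruent {f} {g} f-cong g-cong {x ∷ xs} {y ∷ ys} (x≈y ∷ xs≈ys) = begin
    (f ⊙ g) (x ∷ xs)                      ≡⟨ ⊙-∷ f g x xs ⟩
    f [] * g (x ∷ xs) + (shift x f ⊙ g) xs
      ≈⟨ +-cong (*-congˡ (g-cong (x≈y ∷ xs≈ys))) (⊙-congruent (λ p → f-cong (refl ∷ p)) g-cong xs≈ys) ⟩
    f [] * g (y ∷ ys) + (shift x f ⊙ g) ys
      ≈⟨ +-congˡ (⊙-congˡ g (λ _ → f-cong (x≈y ∷ Pw.refl refl)) ys) ⟩
    f [] * g (y ∷ ys) + (shift y f ⊙ g) ys ≡⟨ ⊙-∷ f g y ys ⟨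
    (f ⊙ g) (y ∷ ys)                      ∎

  ⊙-additive : ∀ {f g} → Additive f → Additive g → Additive (f ⊙ g)
  ⊙-additive {f} {g} f-add g-add [] post x y = begin
    (f ⊙ g) (x + y ∷ post)
      ≡⟨ ⊙-∷ f g (x + y) post ⟩
    f [] * g (x + y ∷ post) + (shift (x + y) f ⊙ g) post
      ≈⟨ split-*+ (g-add [] post x y) (trans (⊙-congˡ g (λ zs → f-add [] zs x y) post) (⊙-distribʳ _ _ g post)) ⟩
    (f [] * g (x ∷ post) + (shift x f ⊙ g) post) + (f [] * g (y ∷ post) + (shift y f ⊙ g) post)
      ≡⟨ ≡.cong₂ _+_ (⊙-∷ f g x post) (⊙-∷ f g y post) ⟨
    (f ⊙ g) (x ∷ post) + (f ⊙ g) (y ∷ post) ∎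
  ⊙-additive {f} {g} f-add g-add (w ∷ pre) post x y = begin
    (f ⊙ g) (w ∷ pre ++ x + y ∷ post)
      ≡⟨ ⊙-∷ f g w _ ⟩
    f [] * g (w ∷ pre ++ x + y ∷ post) + (shift w f ⊙ g) (pre ++ x + y ∷ post)
      ≈⟨ split-*+ (g-add (w ∷ pre) post x y) (⊙-additive (λ pre′ → f-add (w ∷ pre′)) g-add pre post x y) ⟩
    (f [] * g (w ∷ pre ++ x ∷ post) + (shift w f ⊙ g) (pre ++ x ∷ post))
      + (f [] * g (w ∷ pre ++ y ∷ post) + (shift w f ⊙ g) (pre ++ y ∷ post))
      ≡⟨ ≡.cong₂ _+_ (⊙-∷ f g w _) (⊙-∷ f g w _) ⟨
    (f ⊙ g) (w ∷ pre ++ x ∷ post) + (f ⊙ g) (w ∷ pre ++ y ∷ post) ∎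

  ⊙-isMultiAdditive : ∀ {f g} → IsMultiAdditive f → IsMultiAdditive g → IsMultiAdditive (f ⊙ g)
  ⊙-isMultiAdditive f-ma g-ma = record
    { congruent = ⊙-congruent (congruent f-ma) (congruent g-ma)
    ; additive  = ⊙-additive (additive f-ma) (additive g-ma)
    }

  I-isMultiAdditive : IsMultiAdditive I
  I-isMultiAdditive = record { congruent = I-congruent ; additive = I-additive }
    where
    I-congruent : Congruent I
    I-congruent []          = refl
    I-congruent (x≈y ∷ [])  = x≈y
    I-congruent (_ ∷ _ ∷ _) = refl
    I-additive : Additive I
    I-additive []          []      x y = refl
    I-additive []          (_ ∷ _) x y = sym (+-identityˡ 0#)
    I-additive (_ ∷ [])    post    x y = sym (+-identityˡ 0#)
    I-additive (_ ∷ _ ∷ _) post    x y = sym (+-identityˡ 0#)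

  ⊙-[]≈0ˡ : ∀ f g → f [] ≈ 0# → (f ⊙ g) [] ≈ 0#
  ⊙-[]≈0ˡ f g f[]≈0 = trans (⊙-[] f g) (trans (*-congʳ f[]≈0) (zeroˡ _))

  ⊙-[]≈0ʳ : ∀ f g → g [] ≈ 0# → (f ⊙ g) [] ≈ 0#
  ⊙-[]≈0ʳ f g g[]≈0 = trans (⊙-[] f g) (trans (*-congˡ g[]≈0) (zeroʳ _))

  I⊙-∷ : ∀ f x xs → (I ⊙ f) (x ∷ xs) ≈ x * f xs
  I⊙-∷ f x xs = begin
    (I ⊙ f) (x ∷ xs)                      ≡⟨ ⊙-∷ I f x xs ⟩
    0# * f (x ∷ xs) + (shift x I ⊙ f) xs  ≈⟨ +-cong (zeroˡ _) (⊙-congˡ f shift-I xs) ⟩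
    0# + ((λ ys → x * 𝟙 ys) ⊙ f) xs       ≈⟨ +-identityˡ _ ⟩
    ((λ ys → x * 𝟙 ys) ⊙ f) xs            ≈⟨ ⊙-*ˡ x 𝟙 f xs ⟩
    x * (𝟙 ⊙ f) xs                        ≈⟨ *-congˡ (⊙-identityˡ f xs) ⟩
    x * f xs                              ∎
    where
    shift-I : shift x I ≋ (λ ys → x * 𝟙 ys)
    shift-I []      = sym (*-identityʳ x)
    shift-I (_ ∷ _) = sym (zeroʳ x)

  ⊙I-∷ʳ : ∀ f xs x → (f ⊙ I) (xs ++ x ∷ []) ≈ f xs * x
  ⊙I-∷ʳ f []       x = begin
    (f ⊙ I) (x ∷ [])                   ≡⟨ ⊙-∷ f I x [] ⟩
    f [] * x + (shift x f ⊙ I) []      ≈⟨ +-congˡ (trans (⊙-[] (shift x f) I) (zeroʳ _)) ⟩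
    f [] * x + 0#                      ≈⟨ +-identityʳ _ ⟩
    f [] * x                           ∎
  ⊙I-∷ʳ f (w ∷ xs) x = begin
    (f ⊙ I) (w ∷ xs ++ x ∷ [])
      ≡⟨ ⊙-∷ f I w (xs ++ x ∷ []) ⟩
    f [] * I (w ∷ xs ++ x ∷ []) + (shift w f ⊙ I) (xs ++ x ∷ [])
      ≈⟨ +-cong (trans (*-congˡ (I-long xs)) (zeroʳ _)) (⊙I-∷ʳ (shift w f) xs x) ⟩
    0# + f (w ∷ xs) * x
      ≈⟨ +-identityˡ _ ⟩
    f (w ∷ xs) * x ∎
    where
    I-long : ∀ xs → I (w ∷ xs ++ x ∷ []) ≈ 0#
    I-long []      = refl
    I-long (_ ∷ _) = refl

  I⊙-cancel : ∀ {f g} → (I ⊙ f) ≋ (I ⊙ g) → f ≋ g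
  I⊙-cancel {f} {g} I⊙f≋I⊙g xs = begin
    f xs               ≈⟨ *-identityˡ _ ⟨
    1# * f xs          ≈⟨ I⊙-∷ f 1# xs ⟨
    (I ⊙ f) (1# ∷ xs)  ≈⟨ I⊙f≋I⊙g (1# ∷ xs) ⟩
    (I ⊙ g) (1# ∷ xs)  ≈⟨ I⊙-∷ g 1# xs ⟩
    1# * g xs          ≈⟨ *-identityˡ _ ⟩
    g xs               ∎

  ⊙I-cancel : ∀ {f g} → (f ⊙ I) ≋ (g ⊙ I) → f ≋ g
  ⊙I-cancel {f} {g} f⊙I≋g⊙I xs = begin
    f xs                        ≈⟨ *-identityʳ _ ⟨
    f xs * 1#                   ≈⟨ ⊙I-∷ʳ f xs 1# ⟨
    (f ⊙ I) (xs ++ 1# ∷ [])     ≈⟨ f⊙I≋g⊙I (xs ++ 1# ∷ []) ⟩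
    (g ⊙ I) (xs ++ 1# ∷ [])     ≈⟨ ⊙I-∷ʳ g xs 1# ⟩
    g xs * 1#                   ≈⟨ *-identityʳ _ ⟩
    g xs                        ∎

  -- the compositions into exactly l blocks, enumerated in the order `tuples g l` uses
  compositionsWith : ℕ → List Carrier → List (List (List Carrier))
  compositionsWith zero    []      = [] ∷ []
  compositionsWith zero    (_ ∷ _) = []
  compositionsWith (suc l) xs      =
    concatMap (λ p → map (proj₁ p ∷_) (compositionsWith l (proj₂ p))) (splits⁺ xs)

  ∑-tuples : ∀ (φ : List Carrier → Carrier) g l xs →
    ∑ φ (tuples g l xs) ≈ ∑ (φ ∘ map g) (compositionsWith l xs)
  ∑-tuples φ g zero    []       = refl
  ∑-tuples φ g zero    (_ ∷ _)  = refl
  ∑-tuples φ g (suc l) xs       = begin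
    ∑ φ (tuples g (suc l) xs)
      ≈⟨ ∑-concatMap φ _ (splits⁺ xs) ⟩
    ∑ (λ p → ∑ φ (map (g (proj₁ p) ∷_) (tuples g l (proj₂ p)))) (splits⁺ xs)
      ≈⟨ ∑-cong (λ p → trans (reflexive (∑-map φ _ (tuples g l (proj₂ p))))
                             (∑-tuples (φ ∘ (g (proj₁ p) ∷_)) g l (proj₂ p))) (splits⁺ xs) ⟩
    ∑ (λ p → ∑ (λ c → φ (map g (proj₁ p ∷ c))) (compositionsWith l (proj₂ p))) (splits⁺ xs)
      ≈⟨ ∑-cong (λ p → reflexive (∑-map (φ ∘ map g) _ (compositionsWith l (proj₂ p)))) (splits⁺ xs) ⟨
    ∑ (λ p → ∑ (φ ∘ map g) (map (proj₁ p ∷_) (compositionsWith l (proj₂ p)))) (splits⁺ xs)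
      ≈⟨ ∑-concatMap (φ ∘ map g) _ (splits⁺ xs) ⟨
    ∑ (φ ∘ map g) (compositionsWith (suc l) xs) ∎

  ∑-compositionsWith-∷ : ∀ (ψ : List (List Carrier) → Carrier) l x xs →
    ∑ ψ (compositionsWith (suc l) (x ∷ xs))
      ≈ ∑ (λ c → ψ ((x ∷ []) ∷ c)) (compositionsWith l xs) + ∑ (ψ ∘ mergeHead x) (compositionsWith (suc l) xs)
  ∑-compositionsWith-∷ ψ l x xs = begin
    ∑ ψ (compositionsWith (suc l) (x ∷ xs))
      ≈⟨ ∑-concatMap ψ K (map (λ p → (x ∷ proj₁ p , proj₂ p)) (splits xs)) ⟩
    ∑ (λ p → ∑ ψ (K p)) (map (λ p → (x ∷ proj₁ p , proj₂ p)) (splits xs))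
      ≡⟨ ≡.trans (∑-map _ _ (splits xs)) (≡.cong (∑ _) (splits-∷ xs)) ⟩
    ∑ ψ (K (x ∷ [] , xs)) + ∑ (λ p → ∑ ψ (K (x ∷ proj₁ p , proj₂ p))) (splits⁺ xs)
      ≈⟨ +-cong (reflexive (∑-map ψ _ (compositionsWith l xs)))
                (∑-cong (λ p → reflexive (≡.trans (∑-map ψ _ (compositionsWith l (proj₂ p)))
                                                  (≡.sym (∑-map (ψ ∘ mergeHead x) _ (compositionsWith l (proj₂ p))))))
                        (splits⁺ xs)) ⟩
    ∑ (λ c → ψ ((x ∷ []) ∷ c)) (compositionsWith l xs) + ∑ (λ p → ∑ (ψ ∘ mergeHead x) (K p)) (splits⁺ xs)
      ≈⟨ +-congˡ (∑-concatMap (ψ ∘ mergeHead x) K (splits⁺ xs)) ⟨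
    ∑ (λ c → ψ ((x ∷ []) ∷ c)) (compositionsWith l xs) + ∑ (ψ ∘ mergeHead x) (compositionsWith (suc l) xs) ∎
    where
    K : List Carrier × List Carrier → List (List (List Carrier))
    K p = map (proj₁ p ∷_) (compositionsWith l (proj₂ p))
    splits-∷ : ∀ xs → splits xs ≡ ([] , xs) ∷ splits⁺ xs
    splits-∷ []      = ≡.refl
    splits-∷ (_ ∷ _) = ≡.refl

  private
    ∑-upTo-compositionsWith-∷ : ∀ (ψ : List (List Carrier) → Carrier) x xs m →
      ∑ (λ l → ∑ ψ (compositionsWith l (x ∷ xs))) (upTo (suc m))
        ≈ ∑ (λ l → ∑ (λ c → ψ ((x ∷ []) ∷ c)) (compositionsWith l xs)) (upTo m)
          + ∑ (λ l → ∑ (ψ ∘ mergeHead x) (compositionsWith (suc l) xs)) (upTo m)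
    ∑-upTo-compositionsWith-∷ ψ x xs m = begin
      ∑ (λ l → ∑ ψ (compositionsWith l (x ∷ xs))) (upTo (suc m))
        ≡⟨ ∑-upTo-suc _ m ⟩
      0# + ∑ (λ l → ∑ ψ (compositionsWith (suc l) (x ∷ xs))) (upTo m)
        ≈⟨ +-identityˡ _ ⟩
      ∑ (λ l → ∑ ψ (compositionsWith (suc l) (x ∷ xs))) (upTo m)
        ≈⟨ ∑-cong (λ l → ∑-compositionsWith-∷ ψ l x xs) (upTo m) ⟩
      ∑ (λ l → ∑ (λ c → ψ ((x ∷ []) ∷ c)) (compositionsWith l xs)
               + ∑ (ψ ∘ mergeHead x) (compositionsWith (suc l) xs)) (upTo m)
        ≈⟨ ∑-∙ _ _ (upTo m) ⟩
      ∑ (λ l → ∑ (λ c → ψ ((x ∷ []) ∷ c)) (compositionsWith l xs)) (upTo m)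
        + ∑ (λ l → ∑ (ψ ∘ mergeHead x) (compositionsWith (suc l) xs)) (upTo m) ∎

  ∑-upTo-compositionsWith : ∀ (ψ : List (List Carrier) → Carrier) xs m → length xs < m →
    ∑ (λ l → ∑ ψ (compositionsWith l xs)) (upTo m) ≈ ∑ ψ (compositions xs)
  ∑-upTo-compositionsWith ψ [] (suc m) _ =
    trans (reflexive (∑-upTo-suc _ m)) (trans (+-congˡ (∑-zero (λ _ → refl) (upTo m))) (+-identityʳ _))
  ∑-upTo-compositionsWith ψ (x ∷ []) (suc m) (s≤s 0<m) =
    trans (∑-upTo-compositionsWith-∷ ψ x [] m)
          (trans (+-cong (∑-upTo-compositionsWith _ [] m 0<m) (∑-zero (λ _ → refl) (upTo m))) (+-identityʳ _))
  ∑-upTo-compositionsWith ψ (x ∷ y ∷ ys) (suc m) (s≤s |y∷ys|<m) = begin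
    ∑ (λ l → ∑ ψ (compositionsWith l (x ∷ y ∷ ys))) (upTo (suc m))
      ≈⟨ ∑-upTo-compositionsWith-∷ ψ x (y ∷ ys) m ⟩
    ∑ (λ l → ∑ (λ c → ψ ((x ∷ []) ∷ c)) (compositionsWith l (y ∷ ys))) (upTo m)
      + ∑ (λ l → ∑ ψ′ (compositionsWith (suc l) (y ∷ ys))) (upTo m)
      ≈⟨ +-congˡ (+-identityˡ _) ⟨
    ∑ (λ l → ∑ (λ c → ψ ((x ∷ []) ∷ c)) (compositionsWith l (y ∷ ys))) (upTo m)
      + (0# + ∑ (λ l → ∑ ψ′ (compositionsWith (suc l) (y ∷ ys))) (upTo m))
      ≡⟨ ≡.cong (∑ (λ l → ∑ (λ c → ψ ((x ∷ []) ∷ c)) (compositionsWith l (y ∷ ys))) (upTo m) +_)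
                (∑-upTo-suc (λ l → ∑ ψ′ (compositionsWith l (y ∷ ys))) m) ⟨
    ∑ (λ l → ∑ (λ c → ψ ((x ∷ []) ∷ c)) (compositionsWith l (y ∷ ys))) (upTo m)
      + ∑ (λ l → ∑ ψ′ (compositionsWith l (y ∷ ys))) (upTo (suc m))
      ≈⟨ +-cong (∑-upTo-compositionsWith _ (y ∷ ys) m |y∷ys|<m)
                (∑-upTo-compositionsWith ψ′ (y ∷ ys) (suc m) (m<n⇒m<1+n |y∷ys|<m)) ⟩
    ∑ (λ c → ψ ((x ∷ []) ∷ c)) (compositions (y ∷ ys)) + ∑ ψ′ (compositions (y ∷ ys))
      ≈⟨ ∑-compositions-∷-∷ ψ x y ys ⟨
    ∑ ψ (compositions (x ∷ y ∷ ys)) ∎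
    where
    ψ′ : List (List Carrier) → Carrier
    ψ′ = ψ ∘ mergeHead x

  ⊚-compositions : ∀ f g xs → (f ⊚ g) xs ≈ ∑ (λ c → f (map g c)) (compositions xs)
  ⊚-compositions f g xs = begin
    (f ⊚ g) xs
      ≈⟨ sum-concatMap (λ l → map f (tuples g l xs)) (upTo (suc (length xs))) ⟩
    ∑ (λ l → ∑ f (tuples g l xs)) (upTo (suc (length xs)))
      ≈⟨ ∑-cong (λ l → ∑-tuples f g l xs) (upTo (suc (length xs))) ⟩
    ∑ (λ l → ∑ (λ c → f (map g c)) (compositionsWith l xs)) (upTo (suc (length xs)))
      ≈⟨ ∑-upTo-compositionsWith _ xs (suc (length xs)) ≤-refl ⟩
    ∑ (λ c → f (map g c)) (compositions xs) ∎

  ⊚-congˡ : ∀ {f f′} g → f ≋ f′ → (f ⊚ g) ≋ (f′ ⊚ g)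
  ⊚-congˡ {f} {f′} g f≋f′ xs = begin
    (f ⊚ g) xs                                ≈⟨ ⊚-compositions f g xs ⟩
    ∑ (λ c → f (map g c)) (compositions xs)   ≈⟨ ∑-cong (λ c → f≋f′ (map g c)) (compositions xs) ⟩
    ∑ (λ c → f′ (map g c)) (compositions xs)  ≈⟨ ⊚-compositions f′ g xs ⟨
    (f′ ⊚ g) xs                               ∎

  ⊚-congʳ : ∀ {f} → Congruent f → ∀ {g g′} → g ≋ g′ → (f ⊚ g) ≋ (f ⊚ g′)
  ⊚-congʳ {f} f-cong {g} {g′} g≋g′ xs = begin
    (f ⊚ g) xs                                ≈⟨ ⊚-compositions f g xs ⟩
    ∑ (λ c → f (map g c)) (compositions xs)
      ≈⟨ ∑-cong (λ c → f-cong (Pw.map⁺ g g′ (Pw.refl (λ {b} → g≋g′ b)))) (compositions xs) ⟩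
    ∑ (λ c → f (map g′ c)) (compositions xs)  ≈⟨ ⊚-compositions f g′ xs ⟨
    (f ⊚ g′) xs                               ∎

  ⊚-identityˡ : ∀ {g} → g [] ≈ 0# → (I ⊚ g) ≋ g
  ⊚-identityˡ {g} g[]≈0 []       = trans (⊚-compositions I g []) (trans (+-identityʳ 0#) (sym g[]≈0))
  ⊚-identityˡ {g} g[]≈0 (x ∷ xs) =
    trans (⊚-compositions I g (x ∷ xs)) (∑-compositions-oneBlock (λ c → I (map g c)) (λ _ _ _ → refl) x xs)

  ⊚-identityʳ : ∀ {f} → IsMultiAdditive f → (f ⊚ I) ≋ f
  ⊚-identityʳ {f} f-ma xs = begin
    (f ⊚ I) xs                                  ≈⟨ ⊚-compositions f I xs ⟩
    ∑ (λ c → f (map I c)) (compositions xs)     ≈⟨ ∑-compositions-singletons _ longBlock-vanishes xs ⟩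
    f (map I (singletons xs))                   ≡⟨ ≡.cong f (≡.trans (≡.sym (map-∘ xs)) (map-id xs)) ⟩
    f xs                                        ∎
    where
    longBlock-vanishes : ∀ pre x y b post → f (map I (pre ++ (x ∷ y ∷ b) ∷ post)) ≈ 0#
    longBlock-vanishes pre x y b post =
      trans (reflexive (≡.cong f (map-++ I pre _))) (additive-zero f-ma (map I pre) (map I post))

  splits-map : ∀ (h : X → Carrier) xs →
    splits (map h xs) ≡ map (λ p → (map h (proj₁ p) , map h (proj₂ p))) (splitsOf xs)
  splits-map h []       = ≡.refl
  splits-map h (x ∷ xs) = ≡.cong (([] , h x ∷ map h xs) ∷_)
    (≡.trans (≡.cong (map _) (splits-map h xs)) (≡.trans (≡.sym (map-∘ (splitsOf xs))) (map-∘ (splitsOf xs))))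

  splits≡splitsOf : ∀ xs → splits xs ≡ splitsOf xs
  splits≡splitsOf []       = ≡.refl
  splits≡splitsOf (x ∷ xs) = ≡.cong (λ ps → ([] , x ∷ xs) ∷ map (λ p → (x ∷ proj₁ p , proj₂ p)) ps) (splits≡splitsOf xs)

  ⊚-distribʳ-⊙ : ∀ f g u → ((f ⊙ g) ⊚ u) ≋ ((f ⊚ u) ⊙ (g ⊚ u))
  ⊚-distribʳ-⊙ f g u xs = begin
    ((f ⊙ g) ⊚ u) xs
      ≈⟨ ⊚-compositions (f ⊙ g) u xs ⟩
    ∑ (λ c → (f ⊙ g) (map u c)) (compositions xs)
      ≈⟨ ∑-cong (λ c → reflexive (≡.trans (≡.cong (∑ _) (splits-map u c)) (∑-map _ _ (splitsOf c))))
                (compositions xs) ⟩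
    ∑ (λ c → ∑ (uncurry Ψ) (splitsOf c)) (compositions xs)
      ≈⟨ ∑-compositions-splitsOf Ψ xs ⟩
    ∑ (uncurry (∑-compositions² Ψ)) (splitsOf xs)
      ≈⟨ ∑-cong (λ p → factorise (proj₁ p) (proj₂ p)) (splitsOf xs) ⟩
    ∑ (λ p → (f ⊚ u) (proj₁ p) * (g ⊚ u) (proj₂ p)) (splitsOf xs)
      ≡⟨ ≡.cong (∑ _) (splits≡splitsOf xs) ⟨
    ((f ⊚ u) ⊙ (g ⊚ u)) xs ∎
    where
    Ψ : List (List Carrier) → List (List Carrier) → Carrier
    Ψ c₁ c₂ = f (map u c₁) * g (map u c₂)
    factorise : ∀ ys zs → ∑-compositions² Ψ ys zs ≈ (f ⊚ u) ys * (g ⊚ u) zs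
    factorise ys zs = begin
      ∑ (λ c₁ → ∑ (Ψ c₁) (compositions zs)) (compositions ys)
        ≈⟨ ∑-cong (λ c₁ → ∑-distribˡ (f (map u c₁)) _ (compositions zs)) (compositions ys) ⟨
      ∑ (λ c₁ → f (map u c₁) * ∑ (λ c₂ → g (map u c₂)) (compositions zs)) (compositions ys)
        ≈⟨ ∑-distribʳ _ _ (compositions ys) ⟨
      ∑ (λ c₁ → f (map u c₁)) (compositions ys) * ∑ (λ c₂ → g (map u c₂)) (compositions zs)
        ≈⟨ *-cong (⊚-compositions f u ys) (⊚-compositions g u zs) ⟨
      (f ⊚ u) ys * (g ⊚ u) zs ∎

  ⊚-assoc : ∀ {f} → IsMultiAdditive f → ∀ g h → ((f ⊚ g) ⊚ h) ≋ (f ⊚ (g ⊚ h))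
  ⊚-assoc {f} f-ma g h xs = begin
    ((f ⊚ g) ⊚ h) xs
      ≈⟨ ⊚-compositions (f ⊚ g) h xs ⟩
    ∑ (λ c → (f ⊚ g) (map h c)) (compositions xs)
      ≈⟨ ∑-cong inner (compositions xs) ⟩
    ∑ (λ c → ∑ F (compositions c)) (compositions xs)
      ≈⟨ ∑-compositions-compositions F xs ⟩
    ∑ (λ e → ∑ F (choices (map compositions e))) (compositions xs)
      ≈⟨ ∑-cong (λ e → additive-choices f-ma [] φ (map compositions e)) (compositions xs) ⟨
    ∑ (λ e → f (map (∑ φ) (map compositions e))) (compositions xs)
      ≈⟨ ∑-cong outer (compositions xs) ⟩
    ∑ (λ e → f (map (g ⊚ h) e)) (compositions xs)
      ≈⟨ ⊚-compositions f (g ⊚ h) xs ⟨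
    (f ⊚ (g ⊚ h)) xs ∎
    where
    φ : List (List Carrier) → Carrier
    φ b = g (map h b)
    F : List (List (List Carrier)) → Carrier
    F d = f (map φ d)
    inner : ∀ c → (f ⊚ g) (map h c) ≈ ∑ F (compositions c)
    inner c = begin
      (f ⊚ g) (map h c)
        ≈⟨ ⊚-compositions f g (map h c) ⟩
      ∑ (λ d → f (map g d)) (compositions (map h c))
        ≡⟨ ≡.trans (≡.cong (∑ _) (compositions-map h c)) (∑-map _ _ (compositions c)) ⟩
      ∑ (λ d → f (map g (map (map h) d))) (compositions c)
        ≈⟨ ∑-cong (λ d → reflexive (≡.cong f (map-∘ d))) (compositions c) ⟨
      ∑ F (compositions c) ∎
    outer : ∀ e → f (map (∑ φ) (map compositions e)) ≈ f (map (g ⊚ h) e)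
    outer e = trans (reflexive (≡.cong f (≡.sym (map-∘ e))))
                    (congruent f-ma (Pw.map⁺ _ _ (Pw.refl (λ {b} → sym (⊚-compositions g h b)))))

module SeriesInverses {c ℓ b ℓb} {k : CommutativeRing c ℓ} (A : UnitalAlgebra k b ℓb) where
  open MultSeries A
  open SeriesAlgebra A
  open UnitalAlgebra A using (_≈_; 0#; refl)
  open import Relation.Binary.Reasoning.Setoid ≋-setoid

  ⊙-inverseˡ-unique : ∀ {s s⁻¹ t} → IsMulInverse s s⁻¹ → (t ⊙ s) ≋ 𝟙 → t ≋ s⁻¹
  ⊙-inverseˡ-unique {s} {s⁻¹} {t} (s⊙s⁻¹ , _) t⊙s≋𝟙 = begin
    t                 ≈⟨ ⊙-identityʳ t ⟨
    t ⊙ 𝟙             ≈⟨ ⊙-congʳ t s⊙s⁻¹ ⟨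
    t ⊙ (s ⊙ s⁻¹)     ≈⟨ ⊙-assoc t s s⁻¹ ⟨
    (t ⊙ s) ⊙ s⁻¹     ≈⟨ ⊙-congˡ s⁻¹ t⊙s≋𝟙 ⟩
    𝟙 ⊙ s⁻¹           ≈⟨ ⊙-identityˡ s⁻¹ ⟩
    s⁻¹               ∎

  ⊙-inverseʳ-unique : ∀ {s s⁻¹ t} → IsMulInverse s s⁻¹ → (s ⊙ t) ≋ 𝟙 → t ≋ s⁻¹
  ⊙-inverseʳ-unique {s} {s⁻¹} {t} (_ , s⁻¹⊙s) s⊙t≋𝟙 = begin
    t                 ≈⟨ ⊙-identityˡ t ⟨
    𝟙 ⊙ t             ≈⟨ ⊙-congˡ t s⁻¹⊙s ⟨
    (s⁻¹ ⊙ s) ⊙ t     ≈⟨ ⊙-assoc s⁻¹ s t ⟩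
    s⁻¹ ⊙ (s ⊙ t)     ≈⟨ ⊙-congʳ s⁻¹ s⊙t≋𝟙 ⟩
    s⁻¹ ⊙ 𝟙           ≈⟨ ⊙-identityʳ s⁻¹ ⟩
    s⁻¹               ∎

  ⊙-cancelʳ : ∀ {s s⁻¹ f g} → IsMulInverse s s⁻¹ → (f ⊙ s) ≋ (g ⊙ s) → f ≋ g
  ⊙-cancelʳ {s} {s⁻¹} {f} {g} (s⊙s⁻¹ , _) f⊙s≋g⊙s = begin
    f                 ≈⟨ cancel f ⟨
    (f ⊙ s) ⊙ s⁻¹     ≈⟨ ⊙-congˡ s⁻¹ f⊙s≋g⊙s ⟩
    (g ⊙ s) ⊙ s⁻¹     ≈⟨ cancel g ⟩
    g                 ∎
    where
    cancel : ∀ h → ((h ⊙ s) ⊙ s⁻¹) ≋ h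
    cancel h = ≋-trans (⊙-assoc h s s⁻¹) (≋-trans (⊙-congʳ h s⊙s⁻¹) (⊙-identityʳ h))

  F⊚I⊙S≋S⁻¹ : ∀ {F S S⁻¹} → ((I ⊙ F) ⊚ (I ⊙ S)) ≋ I → IsMulInverse S S⁻¹ → (F ⊚ (I ⊙ S)) ≋ S⁻¹
  F⊚I⊙S≋S⁻¹ {F} {S} {S⁻¹} f⊚g≋I S-inv = ⊙-inverseʳ-unique S-inv (I⊙-cancel (begin
    I ⊙ (S ⊙ (F ⊚ g))   ≈⟨ ⊙-assoc I S (F ⊚ g) ⟨
    g ⊙ (F ⊚ g)         ≈⟨ ⊙-congˡ (F ⊚ g) (⊚-identityˡ (⊙-[]≈0ˡ I S refl)) ⟨
    (I ⊚ g) ⊙ (F ⊚ g)   ≈⟨ ⊚-distribʳ-⊙ I F g ⟨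
    (I ⊙ F) ⊚ g         ≈⟨ f⊚g≋I ⟩
    I                   ≈⟨ ⊙-identityʳ I ⟨
    I ⊙ 𝟙               ∎))
    where
    g = I ⊙ S

  F⊚S′⊙I≋S′⁻¹ : ∀ {F S′ S′⁻¹} → ((F ⊙ I) ⊚ (S′ ⊙ I)) ≋ I → IsMulInverse S′ S′⁻¹ → (F ⊚ (S′ ⊙ I)) ≋ S′⁻¹
  F⊚S′⊙I≋S′⁻¹ {F} {S′} {S′⁻¹} q⊚p≋I S′-inv = ⊙-inverseˡ-unique S′-inv (⊙I-cancel (begin
    ((F ⊚ p) ⊙ S′) ⊙ I  ≈⟨ ⊙-assoc (F ⊚ p) S′ I ⟩
    (F ⊚ p) ⊙ p         ≈⟨ ⊙-congʳ (F ⊚ p) (⊚-identityˡ (⊙-[]≈0ʳ S′ I refl)) ⟨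
    (F ⊚ p) ⊙ (I ⊚ p)   ≈⟨ ⊚-distribʳ-⊙ F I p ⟨
    (F ⊙ I) ⊚ p         ≈⟨ q⊚p≋I ⟩
    I                   ≈⟨ ⊙-identityˡ I ⟨
    𝟙 ⊙ I               ∎))
    where
    p = S′ ⊙ I

  module Transforms {F S S⁻¹ S′ S′⁻¹ U⁻¹ : Series}
    (F-ma : IsMultiAdditive F) (S′-ma : IsMultiAdditive S′)
    (S-transform : IsCompInverse (I ⊙ F) (I ⊙ S)) (S-inv : IsMulInverse S S⁻¹)
    (S′-transform : IsCompInverse (F ⊙ I) (S′ ⊙ I)) (S′-inv : IsMulInverse S′ S′⁻¹)
    (U-inv : IsCompInverse ((S⁻¹ ⊙ I) ⊙ S) U⁻¹)
    where

    private
      f g p q U : Series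
      f = I ⊙ F
      g = I ⊙ S
      p = S′ ⊙ I
      q = F ⊙ I
      U = (S⁻¹ ⊙ I) ⊙ S

      p-ma : IsMultiAdditive p
      p-ma = ⊙-isMultiAdditive S′-ma I-isMultiAdditive

      g[]≈0 : g [] ≈ 0#
      g[]≈0 = ⊙-[]≈0ˡ I S refl

      p[]≈0 : p [] ≈ 0#
      p[]≈0 = ⊙-[]≈0ʳ S′ I refl

      U[]≈0 : U [] ≈ 0#
      U[]≈0 = ⊙-[]≈0ˡ (S⁻¹ ⊙ I) S (⊙-[]≈0ʳ S⁻¹ I refl)

      f⊚g≋I : (f ⊚ g) ≋ I
      f⊚g≋I = proj₁ (proj₂ S-transform)

    q⊚g≋U : (q ⊚ g) ≋ U
    q⊚g≋U = begin
      (F ⊙ I) ⊚ g        ≈⟨ ⊚-distribʳ-⊙ F I g ⟩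
      (F ⊚ g) ⊙ (I ⊚ g)  ≈⟨ ⊙-cong (F⊚I⊙S≋S⁻¹ f⊚g≋I S-inv) (⊚-identityˡ g[]≈0) ⟩
      S⁻¹ ⊙ (I ⊙ S)      ≈⟨ ⊙-assoc S⁻¹ I S ⟨
      U                  ∎

    p⊚U≋g : (p ⊚ U) ≋ g
    p⊚U≋g = begin
      p ⊚ U        ≈⟨ ⊚-congʳ (congruent p-ma) q⊚g≋U ⟨
      p ⊚ (q ⊚ g)  ≈⟨ ⊚-assoc p-ma q g ⟨
      (p ⊚ q) ⊚ g  ≈⟨ ⊚-congˡ g (proj₂ (proj₂ S′-transform)) ⟩
      I ⊚ g        ≈⟨ ⊚-identityˡ g[]≈0 ⟩
      g            ∎

    S≋S′⊚U : S ≋ (S′ ⊚ U)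
    S≋S′⊚U = U-cancelʳ (begin
      S ⊙ U              ≈⟨ S⊙U≋g ⟩
      g                  ≈⟨ p⊚U≋g ⟨
      p ⊚ U              ≈⟨ ⊚-distribʳ-⊙ S′ I U ⟩
      (S′ ⊚ U) ⊙ (I ⊚ U) ≈⟨ ⊙-congʳ (S′ ⊚ U) (⊚-identityˡ U[]≈0) ⟩
      (S′ ⊚ U) ⊙ U       ∎)
      where
      reassoc : ∀ h → (((h ⊙ S⁻¹) ⊙ I) ⊙ S) ≋ (h ⊙ U)
      reassoc h = ≋-trans (⊙-congˡ S (⊙-assoc h S⁻¹ I)) (⊙-assoc h (S⁻¹ ⊙ I) S)
      U-cancelʳ : ∀ {h h′} → (h ⊙ U) ≋ (h′ ⊙ U) → h ≋ h′
      U-cancelʳ {h} {h′} h⊙U≋h′⊙U = ⊙-cancelʳ (swap S-inv) (⊙I-cancel (⊙-cancelʳ S-inv (begin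
        ((h ⊙ S⁻¹) ⊙ I) ⊙ S   ≈⟨ reassoc h ⟩
        h ⊙ U                 ≈⟨ h⊙U≋h′⊙U ⟩
        h′ ⊙ U                ≈⟨ reassoc h′ ⟨
        ((h′ ⊙ S⁻¹) ⊙ I) ⊙ S  ∎)))
      S⊙U≋g : (S ⊙ U) ≋ g
      S⊙U≋g = begin
        S ⊙ ((S⁻¹ ⊙ I) ⊙ S)  ≈⟨ ⊙-congʳ S (⊙-assoc S⁻¹ I S) ⟩
        S ⊙ (S⁻¹ ⊙ g)        ≈⟨ ⊙-assoc S S⁻¹ g ⟨
        (S ⊙ S⁻¹) ⊙ g        ≈⟨ ⊙-congˡ g (proj₁ S-inv) ⟩
        𝟙 ⊙ g                ≈⟨ ⊙-identityˡ g ⟩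
        g                    ∎

    U⁻¹≋S′⊙I⊙S′⁻¹ : U⁻¹ ≋ ((S′ ⊙ I) ⊙ S′⁻¹)
    U⁻¹≋S′⊙I⊙S′⁻¹ = begin
      U⁻¹                ≈⟨ ⊚-identityˡ (proj₁ U-inv) ⟨
      I ⊚ U⁻¹            ≈⟨ ⊚-congˡ U⁻¹ f⊚g≋I ⟨
      (f ⊚ g) ⊚ U⁻¹      ≈⟨ ⊚-assoc (⊙-isMultiAdditive I-isMultiAdditive F-ma) g U⁻¹ ⟩
      f ⊚ (g ⊚ U⁻¹)      ≈⟨ ⊚-congʳ (⊙-congruent (congruent I-isMultiAdditive) (congruent F-ma)) g⊚U⁻¹≋p ⟩
      f ⊚ p              ≈⟨ ⊚-distribʳ-⊙ I F p ⟩
      (I ⊚ p) ⊙ (F ⊚ p)  ≈⟨ ⊙-cong (⊚-identityˡ p[]≈0) (F⊚S′⊙I≋S′⁻¹ (proj₁ (proj₂ S′-transform)) S′-inv) ⟩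
      p ⊙ S′⁻¹           ∎
      where
      g⊚U⁻¹≋p : (g ⊚ U⁻¹) ≋ p
      g⊚U⁻¹≋p = begin
        g ⊚ U⁻¹          ≈⟨ ⊚-congˡ U⁻¹ p⊚U≋g ⟨
        (p ⊚ U) ⊚ U⁻¹    ≈⟨ ⊚-assoc p-ma U U⁻¹ ⟩
        p ⊚ (U ⊚ U⁻¹)    ≈⟨ ⊚-congʳ (congruent p-ma) (proj₁ (proj₂ U-inv)) ⟩
        p ⊚ I            ≈⟨ ⊚-identityʳ p-ma ⟩
        p                ∎

-- The field, characteristic-zero and unit-constant hypotheses only serve, in the paper,
-- to guarantee that the inverses exist; given the inverses, the identities are formal.
lemma4p15 : ∀ {c ℓ b ℓb} (k : CommutativeRing c ℓ) → IsField k → CharZero k →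
    (A : UnitalAlgebra k b ℓb) →
    let open MultSeries A in
    (F : Mult) → UnitConst (fn F) →
    -- S_F : f^(∘-1) = I · S_F with S_F ∈ G^inv, and its ⊙-inverse S_F^(-1)
    (S Sinv : Mult) → IsCompInverse (I ⊙ fn F) (I ⊙ fn S) → IsMulInverse (fn S) (fn Sinv) →
    -- left S-transform: S'_F · I = (F · I)^(∘-1), and its ⊙-inverse (S'_F)^(-1)
    (S′ S′inv : Mult) → IsCompInverse (fn F ⊙ I) (fn S′ ⊙ I) → IsMulInverse (fn S′) (fn S′inv) →
    -- U_F = S_F^(-1) · I · S_F and its ∘-inverse U_F^(∘-1)
    (Uinv : Mult) → IsCompInverse ((fn Sinv ⊙ I) ⊙ fn S) (fn Uinv) →
    (fn S ≋ (fn S′ ⊚ ((fn Sinv ⊙ I) ⊙ fn S)))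
      × (fn Uinv ≋ ((fn S′ ⊙ I) ⊙ fn S′inv))
lemma4p15 k _ _ A F _ S Sinv S-transform S-inv S′ S′inv S′-transform S′-inv Uinv U-inv =
  S≋S′⊚U , U⁻¹≋S′⊙I⊙S′⁻¹
  where
  open SeriesAlgebra A using (Mult⇒isMultiAdditive)
  open SeriesInverses.Transforms A (Mult⇒isMultiAdditive F) (Mult⇒isMultiAdditive S′)
                                  S-transform S-inv S′-transform S′-inv U-inv
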